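{- For all $i,j\ge1$, \[ \nu(\tilde a_{i,j})\ge\left\lfloor\tfrac12(5j-i-2)\right\rfloor,\qquad \nu(\tilde b_{i,j})\ge\left\lfloor\tfrac12(5j-i-1)\right\rfloor, \] where $\nu(n)$ denotes the exponent of the exact power of $5$ dividing $n$ (with $\nu(0)=\infty$).
   Context: The matrix $M=(m_{i,j})_{i,j\ge1}$ has first five rows $(5,0,0,0,0,0,\dots)$, $(2\cdot5,\,5^3,0,0,0,0,\dots)$, $(9,\,3\cdot5^3,\,5^5,0,0,0,\dots)$, $(4,\,22\cdot5^2,\,4\cdot5^5,\,5^7,0,0,\dots)$, $(1,\,4\cdot5^3,\,8\cdot5^5,\,5^8,\,5^9,0,\dots)$; for $i\ge6$, $m_{i,1}=0$ and for $j\ge2$, $m_{i,j}=25m_{i-1,j-1}+25m_{i-2,j-1}+15m_{i-3,j-1}+5m_{i-4,j-1}+m_{i-5,j-1}$. Define $\tilde a_{i,j}=m_{6i-4,\,i-1+j}$ and $\tilde b_{i,j}=m_{6i-5,\,i-1+j}$. $\lfloor\cdot\rfloor$ is the floor function. -}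

module Defs where

open import Data.Nat using (ℕ; zero; suc; _+_; _*_; _^_; _∸_)
open import Data.Nat.Divisibility using (_∣_)
open import Data.Integer using (ℤ; +_; -[1+_]; _-_; _/ℕ_)
open import Data.Unit using (⊤)

-- The matrix M = (m i j), 1-indexed; m 0 j = m i 0 = 0 (unused padding).
m : ℕ → ℕ → ℕ
m zero _ = 0
m (suc _) zero = 0
m 1 1 = 5
m 1 (suc (suc _)) = 0
m 2 1 = 2 * 5
m 2 2 = 5 ^ 3
m 2 (suc (suc (suc _))) = 0
m 3 1 = 9
m 3 2 = 3 * 5 ^ 3
m 3 3 = 5 ^ 5
m 3 (suc (suc (suc (suc _)))) = 0
m 4 1 = 4
m 4 2 = 22 * 5 ^ 2
m 4 3 = 4 * 5 ^ 5
m 4 4 = 5 ^ 7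
m 4 (suc (suc (suc (suc (suc _))))) = 0
m 5 1 = 1
m 5 2 = 4 * 5 ^ 3
m 5 3 = 8 * 5 ^ 5
m 5 4 = 5 ^ 8
m 5 5 = 5 ^ 9
m 5 (suc (suc (suc (suc (suc (suc _)))))) = 0
m (suc (suc (suc (suc (suc (suc i)))))) 1 = 0
m (suc (suc (suc (suc (suc (suc i)))))) (suc (suc j)) =
  25 * m (suc (suc (suc (suc (suc i))))) (suc j)
  + 25 * m (suc (suc (suc (suc i)))) (suc j)
  + 15 * m (suc (suc (suc i))) (suc j)
  + 5 * m (suc (suc i)) (suc j)
  + m (suc i) (suc j)

-- ν≥ n k  means  ν₅(n) ≥ k, where ν₅ is the 5-adic valuation with ν₅(0) = ∞.
-- For k ≥ 0 this is exactly 5^k ∣ n; for k < 0 it holds trivially.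
ν≥ : ℕ → ℤ → Set
ν≥ n (+ k) = 5 ^ k ∣ n
ν≥ n -[1+ k ] = ⊤

ã : ℕ → ℕ → ℕ
ã i j = m (6 * i ∸ 4) (i ∸ 1 + j)

b̃ : ℕ → ℕ → ℕ
b̃ i j = m (6 * i ∸ 5) (i ∸ 1 + j)

-- floor((5j - i - c)/2) as an integer (/ℕ is floor division)
flr : ℕ → ℕ → ℕ → ℤ
flr c i j = (+ (5 * j) - + i - + c) /ℕ 2

{-# OPTIONS --safe #-}
module Submission where

-- Write ν for the 5-adic valuation. For i ≥ 6 and j ≥ 2 the recurrence reads
-- m i j = Σ_{r=1}^{5} c_r · m (i − r) (j − 1) with 2ν(c_r) ≥ 5 − r, so the bound
-- ν(m i j) ≥ ⌊(5j − i − 1)/2⌋ passes from column j − 1 to column j; the fifteen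
-- nonzero entries of rows 1–5 satisfy it by inspection. As ã i j and b̃ i j are the
-- entries m (c + 6(i − 1)) (i − 1 + j) with c = 2 and c = 1, the bound there reads
-- ⌊(5j − i − c)/2⌋.

open import Defs
open import Data.Nat using (ℕ; _≥_; zero; suc; _+_; _*_; _^_; _∸_; _≤_; _<_; _≤?_; s≤s⁻¹)
open import Data.Nat.Properties
open import Data.Nat.Divisibility using (_∣_; divides; ∣-trans; _∣0; ∣m∣n⇒∣m+n; m∣m*n; *-pres-∣)
open import Data.Nat.Tactic.RingSolver using (solve)
open import Data.List using (_∷_; [])
open import Data.Integer using (+_; -[1+_]; _-_)
import Data.Integer as ℤ
import Data.Integer.Properties as ℤ
open import Data.Integer.DivMod using ([n/ℕd]*d≤n)
import Data.Integer.Tactic.RingSolver as ℤ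
open import Data.Product using (_×_; _,_)
open import Data.Unit using (tt)
open import Relation.Binary.PropositionalEquality
open import Relation.Nullary using (yes; no)
open import Relation.Nullary.Decidable using (True; toWitness)

^-monoʳ-∣ : ∀ p {m n} → m ≤ n → p ^ m ∣ p ^ n
^-monoʳ-∣ p {m} {n} m≤n = subst (p ^ m ∣_) p^m*p^[n∸m]≡p^n (m∣m*n (p ^ (n ∸ m)))
  where
  p^m*p^[n∸m]≡p^n : p ^ m * p ^ (n ∸ m) ≡ p ^ n
  p^m*p^[n∸m]≡p^n = trans (sym (^-distribˡ-+-* p m (n ∸ m))) (cong (p ^_) (m+[n∸m]≡n m≤n))

-- ν(n) ≥ ⌊(5j − i − 1)/2⌋, phrased without subtraction or rounding; a record, so that
-- i and j stay inferable (they only occur under 2 * k + i and 5 * j).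
record ValuationBound (i j n : ℕ) : Set where
  constructor valuationBound
  field
    bound : ∀ k → 2 * k + i < 5 * j → 5 ^ k ∣ n

open ValuationBound

valuationBound-0 : ∀ {i j} → ValuationBound i j 0
valuationBound-0 = valuationBound λ k _ → (5 ^ k) ∣0

valuationBound-+ : ∀ {i j x y} →
  ValuationBound i j x → ValuationBound i j y → ValuationBound i j (x + y)
valuationBound-+ bx by = valuationBound λ k h → ∣m∣n⇒∣m+n (bound bx k h) (bound by k h)

^∣⇒valuationBound : ∀ {i j n} K → 5 ^ K ∣ n → {_ : True (5 * j ≤? 2 * suc K + i)} →
  ValuationBound i j n
^∣⇒valuationBound {i} {j} K 5^K∣n {5j≤} =
  valuationBound λ k h → ∣-trans (^-monoʳ-∣ 5 (k≤K k h)) 5^K∣n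
  where
  k≤K : ∀ k → 2 * k + i < 5 * j → k ≤ K
  k≤K k h =
    s≤s⁻¹ (*-cancelˡ-< 2 k (suc K) (+-cancelʳ-< i _ _ (<-≤-trans h (toWitness 5j≤))))

valuationBound-shift : ∀ {i j x} a b → {_ : True (5 * b ≤? a)} →
  ValuationBound i j x → ValuationBound (a + i) (b + j) x
valuationBound-shift {i} {j} a b {5b≤a} bx = valuationBound λ k h → bound bx k (lower k h)
  where
  lower : ∀ k → 2 * k + (a + i) < 5 * (b + j) → 2 * k + i < 5 * j
  lower k h = +-cancelʳ-< a _ _ (begin-strict
    2 * k + i + a   ≡⟨ solve (k ∷ i ∷ a ∷ []) ⟩
    2 * k + (a + i) <⟨ h ⟩
    5 * (b + j)     ≡⟨ solve (b ∷ j ∷ []) ⟩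
    5 * j + 5 * b   ≤⟨ +-monoʳ-≤ (5 * j) (toWitness 5b≤a) ⟩
    5 * j + a       ∎)
    where open ≤-Reasoning

valuationBound-scale : ∀ {i j c x} e → 5 ^ e ∣ c →
  ValuationBound (2 * e + i) j x → ValuationBound i j (c * x)
valuationBound-scale {i} {j} {c} {x} e 5^e∣c bx = valuationBound scaled
  where
  scaled : ∀ k → 2 * k + i < 5 * j → 5 ^ k ∣ c * x
  scaled k h with k ≤? e
  ... | yes k≤e = ∣-trans (^-monoʳ-∣ 5 k≤e) (∣-trans 5^e∣c (m∣m*n x))
  ... | no k≰e with m≤n⇒∃[o]m+o≡n (<⇒≤ (≰⇒> k≰e))
  ...   | d , refl = subst (_∣ c * x) (sym (^-distribˡ-+-* 5 e d))
            (*-pres-∣ 5^e∣c (bound bx d (subst (_< 5 * j) rearrange h)))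
    where
    rearrange : 2 * (e + d) + i ≡ 2 * d + (2 * e + i)
    rearrange = solve (e ∷ d ∷ i ∷ [])

m-valuationBound : ∀ i j → ValuationBound i j (m i j)
m-valuationBound zero j = valuationBound-0
m-valuationBound (suc i) zero = valuationBound λ _ ()
m-valuationBound 1 1 = ^∣⇒valuationBound 1 (divides 1 refl)
m-valuationBound 1 (suc (suc _)) = valuationBound-0
m-valuationBound 2 1 = ^∣⇒valuationBound 1 (divides 2 refl)
m-valuationBound 2 2 = ^∣⇒valuationBound 3 (divides 1 refl)
m-valuationBound 2 (suc (suc (suc _))) = valuationBound-0
m-valuationBound 3 1 = ^∣⇒valuationBound 0 (divides 9 refl)
m-valuationBound 3 2 = ^∣⇒valuationBound 3 (divides 3 refl)
m-valuationBound 3 3 = ^∣⇒valuationBound 5 (divides 1 refl)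
m-valuationBound 3 (suc (suc (suc (suc _)))) = valuationBound-0
m-valuationBound 4 1 = ^∣⇒valuationBound 0 (divides 4 refl)
m-valuationBound 4 2 = ^∣⇒valuationBound 2 (divides 22 refl)
m-valuationBound 4 3 = ^∣⇒valuationBound 5 (divides 4 refl)
m-valuationBound 4 4 = ^∣⇒valuationBound 7 (divides 1 refl)
m-valuationBound 4 (suc (suc (suc (suc (suc _))))) = valuationBound-0
m-valuationBound 5 1 = ^∣⇒valuationBound 0 (divides 1 refl)
m-valuationBound 5 2 = ^∣⇒valuationBound 3 (divides 4 refl)
m-valuationBound 5 3 = ^∣⇒valuationBound 5 (divides 8 refl)
m-valuationBound 5 4 = ^∣⇒valuationBound 8 (divides 1 refl)
m-valuationBound 5 5 = ^∣⇒valuationBound 9 (divides 1 refl)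
m-valuationBound 5 (suc (suc (suc (suc (suc (suc _)))))) = valuationBound-0
m-valuationBound (suc (suc (suc (suc (suc (suc i)))))) 1 = valuationBound-0
m-valuationBound (suc (suc (suc (suc (suc (suc i)))))) (suc (suc j)) =
  valuationBound-+ (valuationBound-+ (valuationBound-+ (valuationBound-+
    (valuationBound-scale 2 (divides 1 refl)
      (valuationBound-shift 5 1 (m-valuationBound (5 + i) (suc j))))
    (valuationBound-scale 2 (divides 1 refl)
      (valuationBound-shift 6 1 (m-valuationBound (4 + i) (suc j)))))
    (valuationBound-scale 1 (divides 3 refl)
      (valuationBound-shift 5 1 (m-valuationBound (3 + i) (suc j)))))
    (valuationBound-scale 1 (divides 1 refl)
      (valuationBound-shift 6 1 (m-valuationBound (2 + i) (suc j)))))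
    (valuationBound-shift 5 1 (m-valuationBound (1 + i) (suc j)))

flr-spec : ∀ c i j {k} → flr c i j ≡ + k → 2 * k + i + c ≤ 5 * j
flr-spec c i j {k} eq = ℤ.drop‿+≤+ (begin
    + (2 * k + i + c)               ≡⟨ cong (λ t → + (t + i + c)) (*-comm 2 k) ⟩
    + (k * 2) ℤ.+ + i ℤ.+ + c       ≡⟨ cong (λ t → t ℤ.+ + i ℤ.+ + c) (ℤ.pos-* k 2) ⟩
    + k ℤ.* + 2 ℤ.+ + i ℤ.+ + c     ≡⟨ cong (λ t → t ℤ.* + 2 ℤ.+ + i ℤ.+ + c) (sym eq) ⟩
    flr c i j ℤ.* + 2 ℤ.+ + i ℤ.+ + c
      ≤⟨ ℤ.+-monoˡ-≤ (+ c) (ℤ.+-monoˡ-≤ (+ i) ([n/ℕd]*d≤n n 2)) ⟩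
    n ℤ.+ + i ℤ.+ + c               ≡⟨ subtract-add (+ (5 * j)) (+ i) (+ c) ⟩
    + (5 * j)                       ∎)
  where
  n = + (5 * j) - + i - + c
  subtract-add : ∀ a b c → a - b - c ℤ.+ b ℤ.+ c ≡ a
  subtract-add = ℤ.solve-∀
  open ℤ.≤-Reasoning

ν≥-valuationBound : ∀ {n i j} z → ValuationBound i j n →
  (∀ {k} → z ≡ + k → 2 * k + i < 5 * j) → ν≥ n z
ν≥-valuationBound -[1+ _ ] _ _ = tt
ν≥-valuationBound (+ k) bn below = bound bn k (below refl)

m-ν≥-flr : ∀ c i j → ν≥ (m (c + 6 * i) (i + j)) (flr c (suc i) j)
m-ν≥-flr c i j =
  ν≥-valuationBound (flr c (suc i) j) (m-valuationBound (c + 6 * i) (i + j))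
    (λ {k} eq → below k (flr-spec c (suc i) j eq))
  where
  below : ∀ k → 2 * k + suc i + c ≤ 5 * j → 2 * k + (c + 6 * i) < 5 * (i + j)
  below k h = begin
    suc (2 * k + (c + 6 * i))   ≡⟨ solve (k ∷ c ∷ i ∷ []) ⟩
    5 * i + (2 * k + suc i + c) ≤⟨ +-monoʳ-≤ (5 * i) h ⟩
    5 * i + 5 * j               ≡⟨ *-distribˡ-+ 5 i j ⟨
    5 * (i + j)                 ∎
    where open ≤-Reasoning

6*[1+i]∸d≡[6∸d]+6*i : ∀ i {d} → d ≤ 6 → 6 * suc i ∸ d ≡ (6 ∸ d) + 6 * i
6*[1+i]∸d≡[6∸d]+6*i i {d} d≤6 = trans (cong (_∸ d) (*-suc 6 i)) (+-∸-comm (6 * i) d≤6)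

lemma3p1 : (i j : ℕ) → i ≥ 1 → j ≥ 1 →
    ν≥ (ã i j) (flr 2 i j) × ν≥ (b̃ i j) (flr 1 i j)
lemma3p1 zero j () _
lemma3p1 (suc i) j _ _ = ν≥-row 4 (m≤m+n 4 2) , ν≥-row 5 (m≤m+n 5 1)
  where
  ν≥-row : ∀ d → d ≤ 6 → ν≥ (m (6 * suc i ∸ d) (i + j)) (flr (6 ∸ d) (suc i) j)
  ν≥-row d d≤6 rewrite 6*[1+i]∸d≡[6∸d]+6*i i d≤6 = m-ν≥-flr (6 ∸ d) i j
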